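{- If $G$ is a graph with $\delta=\delta(G)\ge 2$ and $\Delta=\Delta(G)\ge 4\lfloor\delta/2\rfloor-2$, then $$\mathrm{TC}_2(G)\le \Big\lfloor\frac{\delta}{2}\Big\rfloor\Big(\Delta-2\Big\lfloor\frac{\delta}{2}\Big\rfloor+1\Big)+\Big\lceil\frac{\delta}{2}\Big\rceil.$$ Moreover, the bound is sharp for every even minimum degree: for every even $\delta\ge 2$ there exists a graph $G$ with $\delta(G)=\delta$ and $\Delta(G)\ge 4\lfloor\delta/2\rfloor-2$ attaining equality.
   Context: All graphs are finite, simple and connected; $\delta(G)$ and $\Delta(G)$ denote minimum and maximum degree. For a vertex $v$, $N(v)$ denotes its open neighborhood. A set $S\subseteq V(G)$ is a total $2$-dominating set if $|N(v)\cap S|\ge 2$ for every $v\in V(G)$. Two disjoint sets $U,W\subseteq V(G)$ form a total $2$-coalition if neither is a total $2$-dominating set but $U\cup W$ is. A total $2$-coalition partition of $G$ is a partition $\Omega$ of $V(G)$ such that every set of $\Omega$ forms a total $2$-coalition with some other set of $\Omega$. $\mathrm{TC}_2(G)$ is the maximum cardinality of a total $2$-coalition partition of $G$. -}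

module Defs where

open import Data.Nat using (ℕ; zero; suc; _+_; _*_; _∸_; _≤_; _/_)
open import Data.Bool using (Bool; true; false; _∧_; _∨_)
open import Data.Fin using (Fin)
open import Data.Fin.Subset using (∣_∣)
open import Data.Vec using (tabulate)
open import Data.Product using (Σ; _×_; ∃; ∃-syntax)
open import Relation.Binary.PropositionalEquality using (_≡_; _≢_)
open import Relation.Nullary using (¬_)

count : ∀ {n} → (Fin n → Bool) → ℕ
count f = ∣ tabulate f ∣

record Graph (n : ℕ) : Set where
  field
    adj   : Fin n → Fin n → Bool
    sym   : ∀ u v → adj u v ≡ adj v u
    irrefl : ∀ v → adj v v ≡ false
open Graph public

data Reach {n} (G : Graph n) : Fin n → Fin n → Set where
  here : ∀ {v} → Reach G v v
  step : ∀ {u w v} → adj G u w ≡ true → Reach G w v → Reach G u v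

Connected : ∀ {n} → Graph n → Set
Connected G = ∀ u v → Reach G u v

deg : ∀ {n} → Graph n → Fin n → ℕ
deg G v = count (adj G v)

IsMinDeg : ∀ {n} → Graph n → ℕ → Set
IsMinDeg G d = (∀ v → d ≤ deg G v) × (∃[ v ] deg G v ≡ d)

IsMaxDeg : ∀ {n} → Graph n → ℕ → Set
IsMaxDeg G d = (∀ v → deg G v ≤ d) × (∃[ v ] deg G v ≡ d)

VSet : ℕ → Set
VSet n = Fin n → Bool

IsT2D : ∀ {n} → Graph n → VSet n → Set
IsT2D G S = ∀ v → 2 ≤ count (λ u → adj G v u ∧ S u)

-- A partition of V(G) into k (nonempty) classes, given by a surjective
-- class-assignment map; class i is { v | cls v = i }.
record Partition (n k : ℕ) : Set where
  field
    cls  : Fin n → Fin k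
    surj : ∀ i → ∃[ v ] cls v ≡ i
open Partition public

classSet : ∀ {n k} → Partition n k → Fin k → VSet n
classSet P i v with Data.Fin._≟_ (cls P v) i
... | Relation.Nullary.yes _ = true
... | Relation.Nullary.no _ = false
  where import Data.Fin

unionSet : ∀ {n} → VSet n → VSet n → VSet n
unionSet U W v = U v ∨ W v

IsT2Coalition : ∀ {n} → Graph n → VSet n → VSet n → Set
IsT2Coalition G U W = ¬ IsT2D G U × ¬ IsT2D G W × IsT2D G (unionSet U W)

-- a total 2-coalition partition: every class forms a total 2-coalition
-- with some other (distinct, hence disjoint) class
IsT2CoalitionPartition : ∀ {n k} → Graph n → Partition n k → Set
IsT2CoalitionPartition {k = k} G P =
  ∀ (i : Fin k) → ∃[ j ] (i ≢ j × IsT2Coalition G (classSet P i) (classSet P j))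

TC2≤ : ∀ {n} → Graph n → ℕ → Set
TC2≤ {n} G b = ∀ k (P : Partition n k) → IsT2CoalitionPartition G P → k ≤ b

TC2≡ : ∀ {n} → Graph n → ℕ → Set
TC2≡ {n} G b = (Σ (Partition n b) (IsT2CoalitionPartition G)) × TC2≤ G b

bound : ℕ → ℕ → ℕ
bound δ Δ = (δ / 2) * ((Δ + 1) ∸ 2 * (δ / 2)) + (δ + 1) / 2

-- Let x have degree δ and fix a total 2-coalition partition. Call a class lone, heavy or absent
-- according as x has one, at least two or no neighbours in it; then #lone + 2·#heavy ≤ δ, and the
-- coalition partner of an absent class is heavy. No heavy class c is total 2-dominating, so some
-- vertex w_c has at most one neighbour in it. Counting the neighbourhood of a vertex y shows that
-- at most Δ + 1 − 2(e + 1) absent classes have a partner with at most one neighbour of y, where e is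
-- the number of heavy classes in which y has at least two neighbours. Taking y with e minimal, and
-- then each w_c for the e classes c saturated at y, gives #absent ≤ s(Δ + 1 − 2s) with s = e + 1 ≤ #heavy;
-- as s ↦ s(Δ − 2s) is nondecreasing up to ⌊δ/2⌋ (because 4⌊δ/2⌋ ≤ Δ + 2), the bound follows.
--
-- For δ = 2h the bound is attained by h(2h + 1) gadgets, each a complete tripartite graph K_{h,h,h}
-- with an apex joined to two of its parts, plus h top vertices: the h classes "j-th vertex of every
-- part of every gadget" together with the classes "one apex (and a top vertex)" form a total
-- 2-coalition partition with h + h(2h + 1) = bound (2h) (4h) classes.

module Submission where

open import Defs
open import Data.Bool using (Bool; true; false; _∧_; _∨_; not)
import Data.Bool as Bool
open import Data.Bool.Properties using (∧-distribˡ-∨; ∨-zeroʳ; ∧-identityʳ; ∧-zeroʳ)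
open import Data.Empty using (⊥-elim)
open import Data.Fin using (Fin; zero; suc; _≟_; _↑ˡ_; _↑ʳ_; splitAt; combine; remQuot)
open import Data.Fin.Patterns using (0F; 1F; 2F)
import Data.Fin.Properties as Finₚ
open import Data.Nat using (ℕ; zero; suc; _+_; _*_; _∸_; _≤_; _<_; z≤n; s≤s; _/_; _≤?_)
open import Data.Nat.Divisibility using (_∣_; divides)
open import Data.Nat.DivMod using (+-distrib-/-∣ˡ; m/n*n≤m; m*n/n≡m; /-monoˡ-≤)
open import Data.Nat.Properties hiding (_≟_)
open import Data.Nat.Tactic.RingSolver using (solve-∀)
open import Algebra.Properties.Semiring.Sum +-*-semiring
  using (sum; sum-syntax; sum-cong-≗; ∑-distrib-+; ∑-comm; *-distribˡ-sum)
open import Data.Product using (Σ; _×_; _,_; proj₁; proj₂; ∃-syntax; uncurry)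
open import Data.Sum using (_⊎_; inj₁; inj₂; [_,_]′)
open import Function using (_∘_)
open import Relation.Binary.PropositionalEquality hiding (sym)
import Relation.Binary.PropositionalEquality as ≡
open import Relation.Nullary using (¬_; yes; no; does)
open import Relation.Nullary.Decidable using (dec-true; dec-false; _×-dec_)

𝟙 : Bool → ℕ
𝟙 true  = 1
𝟙 false = 0

#_ : ∀ {n} → (Fin n → Bool) → ℕ
# f = sum (𝟙 ∘ f)

count≡# : ∀ {n} (f : Fin n → Bool) → count f ≡ # f
count≡# {zero}  f = refl
count≡# {suc n} f with f zero
... | true  = cong suc (count≡# (f ∘ suc))
... | false = count≡# (f ∘ suc)

𝟙≤1 : ∀ a → 𝟙 a ≤ 1
𝟙≤1 true  = ≤-refl
𝟙≤1 false = z≤n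

𝟙-mono : ∀ {a b} → (a ≡ true → b ≡ true) → 𝟙 a ≤ 𝟙 b
𝟙-mono {true}  a⇒b rewrite a⇒b refl = ≤-refl
𝟙-mono {false} _ = z≤n

∑-mono-≤ : ∀ {n} {v w : Fin n → ℕ} → (∀ i → v i ≤ w i) → sum v ≤ sum w
∑-mono-≤ {zero}  v≤w = z≤n
∑-mono-≤ {suc n} v≤w = +-mono-≤ (v≤w zero) (∑-mono-≤ (v≤w ∘ suc))

∑-const : ∀ n c → ∑[ i < n ] c ≡ n * c
∑-const zero    c = refl
∑-const (suc n) c = cong (c +_) (∑-const n c)

∑-zero : ∀ {n} (w : Fin n → ℕ) → (∀ i → w i ≡ 0) → sum w ≡ 0
∑-zero {n} w w≡0 = trans (sum-cong-≗ {y = λ _ → 0} w≡0) (trans (∑-const n 0) (*-zeroʳ n))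

term≤∑ : ∀ {n} (w : Fin n → ℕ) i → w i ≤ sum w
term≤∑ w zero    = m≤m+n (w zero) _
term≤∑ w (suc i) = ≤-trans (term≤∑ (w ∘ suc) i) (m≤n+m _ (w zero))

∑-point : ∀ {n} (w : Fin n → ℕ) i₀ → (∀ i → i ≢ i₀ → w i ≡ 0) → sum w ≡ w i₀
∑-point w zero w≡0 = trans (cong (w zero +_) (∑-zero (w ∘ suc) (λ i → w≡0 (suc i) λ ()))) (+-identityʳ _)
∑-point w (suc i₀) w≡0 = trans (cong (_+ sum (w ∘ suc)) (w≡0 zero λ ()))
                               (∑-point (w ∘ suc) i₀ (λ i i≢i₀ → w≡0 (suc i) (i≢i₀ ∘ Finₚ.suc-injective)))

_≟ᵇ_ : ∀ {n} → Fin n → Fin n → Bool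
i ≟ᵇ j = does (i ≟ j)

≟ᵇ-refl : ∀ {n} (i : Fin n) → i ≟ᵇ i ≡ true
≟ᵇ-refl i = dec-true (i ≟ i) refl

≢⇒≟ᵇ≡false : ∀ {n} {i j : Fin n} → i ≢ j → i ≟ᵇ j ≡ false
≢⇒≟ᵇ≡false {i = i} {j} = dec-false (i ≟ j)

≟ᵇ⇒≡ : ∀ {n} {i j : Fin n} → i ≟ᵇ j ≡ true → i ≡ j
≟ᵇ⇒≡ {i = i} {j} i≟ᵇj with i ≟ j
... | yes i≡j = i≡j

≟ᵇ≡false⇒≢ : ∀ {n} {i j : Fin n} → i ≟ᵇ j ≡ false → i ≢ j
≟ᵇ≡false⇒≢ {i = i} i≟ᵇi refl with () ← trans (≡.sym (≟ᵇ-refl i)) i≟ᵇi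

≟ᵇ-sym : ∀ {n} (i j : Fin n) → i ≟ᵇ j ≡ j ≟ᵇ i
≟ᵇ-sym i j with i ≟ j | j ≟ i
... | yes _   | yes _   = refl
... | no  _   | no  _   = refl
... | yes i≡j | no  j≢i = ⊥-elim (j≢i (≡.sym i≡j))
... | no  i≢j | yes j≡i = ⊥-elim (i≢j (≡.sym j≡i))

#-cong : ∀ {n} {f g : Fin n → Bool} → (∀ v → f v ≡ g v) → # f ≡ # g
#-cong f≗g = sum-cong-≗ (cong 𝟙 ∘ f≗g)

#-all : ∀ n → # (λ (_ : Fin n) → true) ≡ n
#-all n = trans (∑-const n 1) (*-identityʳ n)

#-mono : ∀ {n} {f g : Fin n → Bool} → (∀ v → f v ≡ true → g v ≡ true) → # f ≤ # g
#-mono f⊆g = ∑-mono-≤ (𝟙-mono ∘ f⊆g)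

#≤n : ∀ {n} (f : Fin n → Bool) → # f ≤ n
#≤n {n} f = ≤-trans (#-mono {f = f} {g = λ _ → true} (λ _ _ → refl)) (≤-reflexive (#-all n))

#-zero : ∀ {n} (f : Fin n → Bool) → (∀ v → f v ≡ false) → # f ≡ 0
#-zero f f≡false = ∑-zero (𝟙 ∘ f) (cong 𝟙 ∘ f≡false)

#-pos : ∀ {n} (f : Fin n → Bool) v → f v ≡ true → 1 ≤ # f
#-pos f v fv = subst (_≤ # f) (cong 𝟙 fv) (term≤∑ (𝟙 ∘ f) v)

#-witness : ∀ {n} (f : Fin n → Bool) → 1 ≤ # f → ∃[ v ] f v ≡ true
#-witness {suc n} f 1≤#f with f zero in f0
... | true  = zero , f0
... | false = let (v , fv) = #-witness (f ∘ suc) 1≤#f in suc v , fv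

#-two : ∀ {n} (f : Fin n → Bool) u w → f u ≡ true → f w ≡ true → u ≢ w → 2 ≤ # f
#-two f zero    zero    _  _  u≢w = ⊥-elim (u≢w refl)
#-two f zero    (suc w) fu fw _   rewrite fu = s≤s (#-pos (f ∘ suc) w fw)
#-two f (suc u) zero    fu fw _   rewrite fw = s≤s (#-pos (f ∘ suc) u fu)
#-two f (suc u) (suc w) fu fw u≢w =
  ≤-trans (#-two (f ∘ suc) u w fu fw (u≢w ∘ cong suc)) (m≤n+m _ (𝟙 (f zero)))

#[i≟ᵇ_]≡1 : ∀ {n} (i : Fin n) → # (i ≟ᵇ_) ≡ 1
#[i≟ᵇ_]≡1 i = trans (∑-point _ i λ j j≢i → cong 𝟙 (≢⇒≟ᵇ≡false (j≢i ∘ ≡.sym))) (cong 𝟙 (≟ᵇ-refl i))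

#-≤1 : ∀ {n} (f : Fin n → Bool) u → (∀ v → f v ≡ true → v ≡ u) → # f ≤ 1
#-≤1 f u f⊆u = ≤-trans (#-mono (λ v fv → subst (λ v → u ≟ᵇ v ≡ true) (≡.sym (f⊆u v fv)) (≟ᵇ-refl u)))
                       (≤-reflexive (#[i≟ᵇ_]≡1 u))

#-∨ : ∀ {n} (f g : Fin n → Bool) → (∀ v → f v ∧ g v ≡ false) → # (λ v → f v ∨ g v) ≡ # f + # g
#-∨ f g disjoint = trans (sum-cong-≗ 𝟙-∨) (∑-distrib-+ (𝟙 ∘ f) (𝟙 ∘ g))
  where
  𝟙-∨ : ∀ v → 𝟙 (f v ∨ g v) ≡ 𝟙 (f v) + 𝟙 (g v)
  𝟙-∨ v with f v | g v | disjoint v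
  ... | true  | false | _ = refl
  ... | false | true  | _ = refl
  ... | false | false | _ = refl

#-split : ∀ {n} (f g : Fin n → Bool) → # f ≡ # (λ v → f v ∧ g v) + # (λ v → f v ∧ not (g v))
#-split f g = trans (sum-cong-≗ 𝟙-split) (∑-distrib-+ (λ v → 𝟙 (f v ∧ g v)) (λ v → 𝟙 (f v ∧ not (g v))))
  where
  𝟙-split : ∀ v → 𝟙 (f v) ≡ 𝟙 (f v ∧ g v) + 𝟙 (f v ∧ not (g v))
  𝟙-split v with f v | g v
  ... | true  | true  = refl
  ... | true  | false = refl
  ... | false | _     = refl

#-complement : ∀ {n} (f : Fin n → Bool) → # f + # (not ∘ f) ≡ n
#-complement {n} f = trans (≡.sym (#-split (λ _ → true) f)) (#-all n)

∑-fibres : ∀ {m n} (φ : Fin m → Fin n) (S : Fin m → Bool) →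
           ∑[ j < n ] # (λ v → S v ∧ φ v ≟ᵇ j) ≡ # S
∑-fibres {n = n} φ S = trans (∑-comm (λ j v → 𝟙 (S v ∧ φ v ≟ᵇ j))) (sum-cong-≗ fibre)
  where
  fibre : ∀ v → ∑[ j < n ] 𝟙 (S v ∧ φ v ≟ᵇ j) ≡ 𝟙 (S v)
  fibre v = trans (∑-point _ (φ v) λ j j≢φv → trans (cong (λ b → 𝟙 (S v ∧ b)) (≢⇒≟ᵇ≡false (j≢φv ∘ ≡.sym)))
                                                    (cong 𝟙 (∧-zeroʳ (S v))))
                  (trans (cong (λ b → 𝟙 (S v ∧ b)) (≟ᵇ-refl (φ v))) (cong 𝟙 (∧-identityʳ (S v))))

∑-+ : ∀ m n (w : Fin (m + n) → ℕ) → sum w ≡ ∑[ i < m ] w (i ↑ˡ n) + ∑[ j < n ] w (m ↑ʳ j)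
∑-+ zero    n w = refl
∑-+ (suc m) n w = trans (cong (w zero +_) (∑-+ m n (w ∘ suc))) (≡.sym (+-assoc (w zero) _ _))

∑-* : ∀ m n (w : Fin (m * n) → ℕ) → sum w ≡ ∑[ i < m ] ∑[ j < n ] w (combine i j)
∑-* zero    n w = refl
∑-* (suc m) n w = trans (∑-+ n (m * n) w) (cong (∑[ j < n ] w (combine {suc m} zero j) +_) (∑-* m n (w ∘ (n ↑ʳ_))))

∑∑-point : ∀ {m n} (F : Fin m → Fin n → ℕ) i₀ j₀ →
           (∀ i j → (i₀ ≟ᵇ i ∧ j₀ ≟ᵇ j) ≡ false → F i j ≡ 0) →
           ∑[ i < m ] ∑[ j < n ] F i j ≡ F i₀ j₀
∑∑-point F i₀ j₀ F≡0 =
  trans (∑-point _ i₀ λ i i≢i₀ → ∑-zero (F i) λ j → F≡0 i j (cong (_∧ _) (≢⇒≟ᵇ≡false (i≢i₀ ∘ ≡.sym))))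
        (∑-point (F i₀) j₀ λ j j≢j₀ → F≡0 i₀ j (cong₂ _∧_ (≟ᵇ-refl i₀) (≢⇒≟ᵇ≡false (j≢j₀ ∘ ≡.sym))))

argmin : ∀ {n} → Fin n → (f : Fin n → ℕ) → ∃[ m ] (∀ y → f m ≤ f y)
argmin {suc zero}    _ f = zero , λ { zero → ≤-refl }
argmin {suc (suc n)} _ f with argmin zero (f ∘ suc)
... | m , fm≤ with f (suc m) ≤? f zero
...   | yes fm≤f0 = suc m , λ { zero → fm≤f0 ; (suc y) → fm≤ y }
...   | no  fm≰f0 = zero , λ { zero → ≤-refl ; (suc y) → ≤-trans (<⇒≤ (≰⇒> fm≰f0)) (fm≤ y) }

[2+d]/2≡ : ∀ d → (2 + d) / 2 ≡ suc (d / 2)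
[2+d]/2≡ d = +-distrib-/-∣ˡ {2} d {2} (divides 1 refl)

/2+[1+]/2≡ : ∀ d → d / 2 + (d + 1) / 2 ≡ d
/2+[1+]/2≡ zero          = refl
/2+[1+]/2≡ (suc zero)    = refl
/2+[1+]/2≡ (suc (suc d)) rewrite [2+d]/2≡ d | [2+d]/2≡ (d + 1) =
  cong suc (trans (+-suc (d / 2) _) (cong suc (/2+[1+]/2≡ d)))

2*[/2]≤ : ∀ d → 2 * (d / 2) ≤ d
2*[/2]≤ d = subst (_≤ d) (*-comm (d / 2) 2) (m/n*n≤m d 2)

≤/2 : ∀ {t d} → 2 * t ≤ d → t ≤ d / 2
≤/2 {t} {d} 2t≤d = subst (_≤ d / 2) (m*n/n≡m t 2) (/-monoˡ-≤ 2 (subst (_≤ d) (*-comm 2 t) 2t≤d))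

x*[Δ∸2x]-step : ∀ Δ x → 4 * x + 2 ≤ Δ → x * (Δ ∸ 2 * x) ≤ suc x * (Δ ∸ 2 * suc x)
x*[Δ∸2x]-step Δ x 4x+2≤Δ = begin
  x * (Δ ∸ 2 * x)     ≡⟨ cong (x *_) Δ∸2x≡w+2 ⟩
  x * (w + 2)         ≡⟨ e₁ x w ⟩
  x * w + 2 * x       ≤⟨ +-monoʳ-≤ (x * w) 2x≤w ⟩
  x * w + w           ≡⟨ +-comm (x * w) w ⟩
  suc x * w           ∎
  where
  open ≤-Reasoning
  w : ℕ
  w = Δ ∸ 2 * suc x
  e₁ : ∀ x w → x * (w + 2) ≡ x * w + 2 * x
  e₁ = solve-∀
  e₂ : ∀ x w → w + 2 * suc x ≡ w + 2 + 2 * x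
  e₂ = solve-∀
  e₃ : ∀ x → 4 * x + 2 ≡ 2 * x + 2 * suc x
  e₃ = solve-∀
  w+2[1+x]≡Δ : w + 2 * suc x ≡ Δ
  w+2[1+x]≡Δ = m∸n+n≡m (≤-trans (m≤n+m (2 * suc x) (2 * x)) (subst (_≤ Δ) (e₃ x) 4x+2≤Δ))
  Δ∸2x≡w+2 : Δ ∸ 2 * x ≡ w + 2
  Δ∸2x≡w+2 = trans (cong (_∸ 2 * x) (trans (≡.sym w+2[1+x]≡Δ) (e₂ x w))) (m+n∸n≡m (w + 2) (2 * x))
  2x≤w : 2 * x ≤ w
  2x≤w = +-cancelʳ-≤ (2 * suc x) (2 * x) w (subst₂ _≤_ (e₃ x) (≡.sym w+2[1+x]≡Δ) 4x+2≤Δ)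

x*[Δ∸2x]-mono : ∀ Δ {s} h → s ≤ h → 4 * h ≤ Δ + 2 → s * (Δ ∸ 2 * s) ≤ h * (Δ ∸ 2 * h)
x*[Δ∸2x]-mono Δ zero    z≤n   _          = ≤-refl
x*[Δ∸2x]-mono Δ (suc h) s≤1+h 4[1+h]≤Δ+2 with m≤n⇒m<n∨m≡n s≤1+h
... | inj₂ refl      = ≤-refl
... | inj₁ (s≤s s≤h) = ≤-trans (x*[Δ∸2x]-mono Δ h s≤h (≤-trans (m≤m+n (4 * h) 4) 4h+4≤Δ+2))
                               (x*[Δ∸2x]-step Δ h (+-cancelʳ-≤ 2 (4 * h + 2) Δ (subst (_≤ Δ + 2) (e h) 4h+4≤Δ+2)))
  where
  e : ∀ h → 4 * h + 4 ≡ 4 * h + 2 + 2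
  e = solve-∀
  4h+4≤Δ+2 : 4 * h + 4 ≤ Δ + 2
  4h+4≤Δ+2 = subst (_≤ Δ + 2) (trans (*-suc 4 h) (+-comm 4 (4 * h))) 4[1+h]≤Δ+2

x*[Δ+1∸2x]≡ : ∀ Δ x → 2 * x ≤ Δ → x * (Δ + 1 ∸ 2 * x) ≡ x * (Δ ∸ 2 * x) + x
x*[Δ+1∸2x]≡ Δ x 2x≤Δ = begin-equality
  x * (Δ + 1 ∸ 2 * x)   ≡⟨ cong (x *_) (+-∸-comm 1 2x≤Δ) ⟩
  x * (Δ ∸ 2 * x + 1)   ≡⟨ *-distribˡ-+ x (Δ ∸ 2 * x) 1 ⟩
  x * (Δ ∸ 2 * x) + x * 1 ≡⟨ cong (x * (Δ ∸ 2 * x) +_) (*-identityʳ x) ⟩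
  x * (Δ ∸ 2 * x) + x   ∎
  where open ≤-Reasoning

≤bound : ∀ {k a t s δ Δ} → k ≤ a + t + s * (Δ + 1 ∸ 2 * s) → a + 2 * t ≤ δ → s ≤ t →
         4 * (δ / 2) ∸ 2 ≤ Δ → δ ≤ Δ → k ≤ bound δ Δ
≤bound {k} {a} {t} {s} {δ} {Δ} k≤ a+2t≤δ s≤t 4h∸2≤Δ δ≤Δ = begin
  k                                   ≤⟨ k≤ ⟩
  a + t + s * (Δ + 1 ∸ 2 * s)         ≡⟨ cong (a + t +_) (x*[Δ+1∸2x]≡ Δ s (≤-trans (*-monoʳ-≤ 2 s≤h) 2h≤Δ)) ⟩
  a + t + (s * (Δ ∸ 2 * s) + s)       ≤⟨ +-monoʳ-≤ (a + t) (+-mono-≤ (x*[Δ∸2x]-mono Δ h s≤h 4h≤Δ+2) s≤t) ⟩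
  a + t + (h * (Δ ∸ 2 * h) + t)       ≡⟨ e a t (h * (Δ ∸ 2 * h)) ⟩
  (a + 2 * t) + h * (Δ ∸ 2 * h)       ≤⟨ +-monoˡ-≤ _ a+2t≤δ ⟩
  δ + h * (Δ ∸ 2 * h)                 ≡⟨ cong (_+ h * (Δ ∸ 2 * h)) (≡.sym (/2+[1+]/2≡ δ)) ⟩
  h + c + h * (Δ ∸ 2 * h)             ≡⟨ e′ h c (h * (Δ ∸ 2 * h)) ⟩
  (h * (Δ ∸ 2 * h) + h) + c           ≡⟨ cong (_+ c) (≡.sym (x*[Δ+1∸2x]≡ Δ h 2h≤Δ)) ⟩
  bound δ Δ                           ∎
  where
  open ≤-Reasoning
  h c : ℕ
  h = δ / 2
  c = (δ + 1) / 2
  e : ∀ a t p → a + t + (p + t) ≡ (a + 2 * t) + p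
  e = solve-∀
  e′ : ∀ h c p → h + c + p ≡ (p + h) + c
  e′ = solve-∀
  s≤h : s ≤ h
  s≤h = ≤-trans s≤t (≤/2 (≤-trans (m≤n+m (2 * t) a) a+2t≤δ))
  2h≤Δ : 2 * h ≤ Δ
  2h≤Δ = ≤-trans (2*[/2]≤ δ) δ≤Δ
  4h≤Δ+2 : 4 * h ≤ Δ + 2
  4h≤Δ+2 = ≤-trans (m≤n+m∸n (4 * h) 2) (subst (2 + (4 * h ∸ 2) ≤_) (+-comm 2 Δ) (+-monoʳ-≤ 2 4h∸2≤Δ))

∑-weighted : ∀ {n} (a b : Fin n → Bool) wa wb →
             ∑[ i < n ] (wa * 𝟙 (a i) + wb * 𝟙 (b i)) ≡ wa * # a + wb * # b
∑-weighted a b wa wb = trans (∑-distrib-+ (λ i → wa * 𝟙 (a i)) (λ i → wb * 𝟙 (b i)))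
                             (≡.sym (cong₂ _+_ (*-distribˡ-sum wa (𝟙 ∘ a)) (*-distribˡ-sum wb (𝟙 ∘ b))))

∧-true⁻ : ∀ {a b} → a ∧ b ≡ true → a ≡ true × b ≡ true
∧-true⁻ {true} b≡true = refl , b≡true

∧-true⁺ : ∀ {a b} → a ≡ true → b ≡ true → a ∧ b ≡ true
∧-true⁺ refl refl = refl

not-true⁻ : ∀ {b} → not b ≡ true → b ≡ false
not-true⁻ {false} _ = refl

not-true⁺ : ∀ {b} → b ≡ false → not b ≡ true
not-true⁺ refl = refl

∨-true⁻ : ∀ {a b} → a ∨ b ≡ true → a ≡ true ⊎ b ≡ true
∨-true⁻ {true}  _      = inj₁ refl
∨-true⁻ {false} b≡true = inj₂ b≡true

weights≤ : ∀ {a b} wa wb m → (a ≡ true → b ≡ false) → (a ≡ true → wa ≤ m) → (b ≡ true → wb ≤ m) →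
           wa * 𝟙 a + wb * 𝟙 b ≤ m
weights≤ {true}  {false} wa wb m _ wa≤m _ =
  subst (_≤ m) (≡.sym (trans (cong₂ _+_ (*-identityʳ wa) (*-zeroʳ wb)) (+-identityʳ wa))) (wa≤m refl)
weights≤ {true}  {true}  wa wb m a⇒¬b _ _ with () ← a⇒¬b refl
weights≤ {false} {true}  wa wb m _ _ wb≤m = subst (_≤ m) (≡.sym (cong₂ _+_ (*-zeroʳ wa) (*-identityʳ wb))) (wb≤m refl)
weights≤ {false} {false} wa wb m _ _ _    = subst (_≤ m) (≡.sym (cong₂ _+_ (*-zeroʳ wa) (*-zeroʳ wb))) z≤n

isZero isOne isLarge : ℕ → Bool
isZero zero = true
isZero _    = false
isOne (suc zero) = true
isOne _          = false
isLarge (suc (suc _)) = true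
isLarge _             = false

𝟙isOne+2𝟙isLarge≤ : ∀ m → 𝟙 (isOne m) + 2 * 𝟙 (isLarge m) ≤ m
𝟙isOne+2𝟙isLarge≤ zero          = z≤n
𝟙isOne+2𝟙isLarge≤ (suc zero)    = ≤-refl
𝟙isOne+2𝟙isLarge≤ (suc (suc m)) = s≤s (s≤s z≤n)

𝟙isOne+𝟙isLarge+𝟙isZero≡1 : ∀ m → 𝟙 (isOne m) + 𝟙 (isLarge m) + 𝟙 (isZero m) ≡ 1
𝟙isOne+𝟙isLarge+𝟙isZero≡1 zero          = refl
𝟙isOne+𝟙isLarge+𝟙isZero≡1 (suc zero)    = refl
𝟙isOne+𝟙isLarge+𝟙isZero≡1 (suc (suc m)) = refl

2≤⇒isLarge : ∀ {m} → 2 ≤ m → isLarge m ≡ true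
2≤⇒isLarge {suc (suc m)} _ = refl
2≤⇒isLarge {suc zero} (s≤s ())

isZero⇒≡0 : ∀ {m} → isZero m ≡ true → m ≡ 0
isZero⇒≡0 {zero} _ = refl

isLarge⇒2≤ : ∀ {m} → isLarge m ≡ true → 2 ≤ m
isLarge⇒2≤ {suc (suc m)} _ = s≤s (s≤s z≤n)

¬isLarge⇒≤1 : ∀ {m} → isLarge m ≡ false → m ≤ 1
¬isLarge⇒≤1 {zero}       _ = z≤n
¬isLarge⇒≤1 {suc zero}   _ = ≤-refl

≤1⇒¬isLarge : ∀ {m} → m ≤ 1 → isLarge m ≡ false
≤1⇒¬isLarge {zero}     _ = refl
≤1⇒¬isLarge {suc zero} _ = refl
≤1⇒¬isLarge {suc (suc m)} (s≤s ())

2≤+⇒≤1⇒1≤ : ∀ {m m′} → 2 ≤ m + m′ → m ≤ 1 → 1 ≤ m′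
2≤+⇒≤1⇒1≤ {zero}     2≤m′     _ = ≤-trans (s≤s z≤n) 2≤m′
2≤+⇒≤1⇒1≤ {suc zero} (s≤s 1≤m′) _ = 1≤m′
2≤+⇒≤1⇒1≤ {suc (suc m)} _ (s≤s ())

q≤Δ+1∸2[1+e]-from-pairs : ∀ {q e Δ} → 2 * e + 2 * q ≤ Δ → q ≤ Δ + 1 ∸ 2 * suc e
q≤Δ+1∸2[1+e]-from-pairs {zero}  _ = z≤n
q≤Δ+1∸2[1+e]-from-pairs {suc q} {e} {Δ} 2e+2q≤Δ = m+n≤o⇒m≤o∸n (suc q) (begin
  suc q + 2 * suc e              ≡⟨ e₁ q e ⟩
  (2 * e + 2 * suc q + 1) ∸ q    ≤⟨ ∸-monoˡ-≤ q (+-monoˡ-≤ 1 2e+2q≤Δ) ⟩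
  Δ + 1 ∸ q                      ≤⟨ m∸n≤m (Δ + 1) q ⟩
  Δ + 1                          ∎)
  where
  open ≤-Reasoning
  e₂ : ∀ q e → 2 * e + 2 * suc q + 1 ≡ suc q + 2 * suc e + q
  e₂ = solve-∀
  e₁ : ∀ q e → suc q + 2 * suc e ≡ (2 * e + 2 * suc q + 1) ∸ q
  e₁ q e = ≡.sym (trans (cong (_∸ q) (e₂ q e)) (m+n∸n≡m (suc q + 2 * suc e) q))

q≤Δ+1∸2[1+e]-from-single : ∀ {q e Δ} → 2 * e + (q + 1) ≤ Δ → q ≤ Δ + 1 ∸ 2 * suc e
q≤Δ+1∸2[1+e]-from-single {q} {e} {Δ} 2e+q+1≤Δ = m+n≤o⇒m≤o∸n q (subst (_≤ Δ + 1) (e₁ q e) (+-monoˡ-≤ 1 2e+q+1≤Δ))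
  where
  e₁ : ∀ q e → 2 * e + (q + 1) + 1 ≡ q + 2 * suc e
  e₁ = solve-∀

Reach-snoc : ∀ {n} {G : Graph n} {u w v} → Reach G u w → adj G w v ≡ true → Reach G u v
Reach-snoc here             w~v = step w~v here
Reach-snoc (step u~u′ u′⇝w) w~v = step u~u′ (Reach-snoc u′⇝w w~v)

Reach-sym : ∀ {n} {G : Graph n} {u v} → Reach G u v → Reach G v u
Reach-sym         here                      = here
Reach-sym {G = G} (step {u} {w} u~w w⇝v) = Reach-snoc (Reach-sym w⇝v) (trans (Graph.sym G w u) u~w)

Reach-trans : ∀ {n} {G : Graph n} {u w v} → Reach G u w → Reach G w v → Reach G u v
Reach-trans here               w⇝v = w⇝v
Reach-trans (step u~u′ u′⇝w) w⇝v = step u~u′ (Reach-trans u′⇝w w⇝v)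

classSet≡ : ∀ {n k} (P : Partition n k) i u → classSet P i u ≡ cls P u ≟ᵇ i
classSet≡ P i u with cls P u ≟ i
... | yes _ = refl
... | no  _ = refl

¬T2D-by-vertex : ∀ {n} (G : Graph n) (S : VSet n) v w → (∀ u → adj G v u ∧ S u ≡ true → u ≡ w) → ¬ IsT2D G S
¬T2D-by-vertex G S v w N[v]∩S⊆w S-dominating =
  <-irrefl refl (≤-trans (subst (2 ≤_) (count≡# (λ u → adj G v u ∧ S u)) (S-dominating v)) (#-≤1 _ w N[v]∩S⊆w))

module UpperBound {n k} (G : Graph n) (P : Partition n k) (coalition : IsT2CoalitionPartition G P) where

  degIn : Fin n → Fin k → ℕ
  degIn y i = # λ u → adj G y u ∧ classSet P i u

  ∑degIn≡deg : ∀ y → ∑[ i < k ] degIn y i ≡ deg G y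
  ∑degIn≡deg y = begin
    ∑[ i < k ] degIn y i
      ≡⟨ sum-cong-≗ (λ i → #-cong λ u → cong (adj G y u ∧_) (classSet≡ P i u)) ⟩
    ∑[ i < k ] # (λ u → adj G y u ∧ cls P u ≟ᵇ i)
      ≡⟨ ∑-fibres (cls P) (adj G y) ⟩
    # adj G y
      ≡⟨ count≡# (adj G y) ⟨
    deg G y ∎
    where open ≡-Reasoning

  degIn-∪ : ∀ {i j} → i ≢ j → ∀ v →
            count (λ u → adj G v u ∧ unionSet (classSet P i) (classSet P j) u) ≡ degIn v i + degIn v j
  degIn-∪ {i} {j} i≢j v = begin
    count (λ u → adj G v u ∧ unionSet (classSet P i) (classSet P j) u)
      ≡⟨ count≡# (λ u → adj G v u ∧ unionSet (classSet P i) (classSet P j) u) ⟩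
    # (λ u → adj G v u ∧ (classSet P i u ∨ classSet P j u))
      ≡⟨ #-cong (λ u → ∧-distribˡ-∨ (adj G v u) _ _) ⟩
    # (λ u → (adj G v u ∧ classSet P i u) ∨ (adj G v u ∧ classSet P j u))
      ≡⟨ #-∨ _ _ disjoint ⟩
    degIn v i + degIn v j ∎
    where
    open ≡-Reasoning
    disjoint : ∀ u → (adj G v u ∧ classSet P i u) ∧ (adj G v u ∧ classSet P j u) ≡ false
    disjoint u rewrite classSet≡ P i u | classSet≡ P j u with adj G v u | cls P u ≟ i
    ... | false | _        = refl
    ... | true  | no  _    = refl
    ... | true  | yes refl = ≢⇒≟ᵇ≡false i≢j

  partner : Fin k → Fin k
  partner i = proj₁ (coalition i)

  2≤degIn+degIn-partner : ∀ i v → 2 ≤ degIn v i + degIn v (partner i)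
  2≤degIn+degIn-partner i v with coalition i
  ... | _ , i≢j , _ , _ , union-dominating = subst (2 ≤_) (degIn-∪ i≢j v) (union-dominating v)

  undominated : ∀ i → ∃[ v ] degIn v i ≤ 1
  undominated i with Finₚ.¬∀⟶∃¬ n _ (λ v → 2 ≤? _) (proj₁ (proj₂ (proj₂ (coalition i))))
  ... | v , 2≰ = v , subst (_≤ 1) (count≡# (λ u → adj G v u ∧ classSet P i u)) (≤-pred (≰⇒> 2≰))

  witness : Fin k → Fin n
  witness i = proj₁ (undominated i)

  degIn-witness≤1 : ∀ i → degIn (witness i) i ≤ 1
  degIn-witness≤1 i = proj₂ (undominated i)

  module AtMinimumDegreeVertex (x : Fin n) {δ Δ : ℕ} (deg-x : deg G x ≡ δ) (deg≤Δ : ∀ v → deg G v ≤ Δ) where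

    Lone Heavy Absent : Fin k → Bool
    Lone   i = isOne   (degIn x i)
    Heavy  i = isLarge (degIn x i)
    Absent i = isZero  (degIn x i)

    lone+2heavy≤δ : # Lone + 2 * # Heavy ≤ δ
    lone+2heavy≤δ = begin
      # Lone + 2 * # Heavy                          ≡⟨ cong (# Lone +_) (*-distribˡ-sum 2 (𝟙 ∘ Heavy)) ⟩
      # Lone + ∑[ i < k ] (2 * 𝟙 (Heavy i))         ≡⟨ ∑-distrib-+ (𝟙 ∘ Lone) (λ i → 2 * 𝟙 (Heavy i)) ⟨
      ∑[ i < k ] (𝟙 (Lone i) + 2 * 𝟙 (Heavy i))     ≤⟨ ∑-mono-≤ (𝟙isOne+2𝟙isLarge≤ ∘ degIn x) ⟩
      ∑[ i < k ] degIn x i                          ≡⟨ ∑degIn≡deg x ⟩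
      deg G x                                       ≡⟨ deg-x ⟩
      δ                                             ∎
      where open ≤-Reasoning

    k≡lone+heavy+absent : k ≡ # Lone + # Heavy + # Absent
    k≡lone+heavy+absent = begin
      k
        ≡⟨ trans (∑-const k 1) (*-identityʳ k) ⟨
      ∑[ i < k ] 1
        ≡⟨ sum-cong-≗ (𝟙isOne+𝟙isLarge+𝟙isZero≡1 ∘ degIn x) ⟨
      ∑[ i < k ] (𝟙 (Lone i) + 𝟙 (Heavy i) + 𝟙 (Absent i))
        ≡⟨ ∑-distrib-+ (λ i → 𝟙 (Lone i) + 𝟙 (Heavy i)) (𝟙 ∘ Absent) ⟩
      ∑[ i < k ] (𝟙 (Lone i) + 𝟙 (Heavy i)) + # Absent
        ≡⟨ cong (_+ # Absent) (∑-distrib-+ (𝟙 ∘ Lone) (𝟙 ∘ Heavy)) ⟩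
      # Lone + # Heavy + # Absent ∎
      where open ≡-Reasoning

    absent⇒¬heavy : ∀ {i} → Absent i ≡ true → Heavy i ≡ false
    absent⇒¬heavy {i} absent rewrite isZero⇒≡0 absent = refl

    absent⇒heavy-partner : ∀ {i} → Absent i ≡ true → Heavy (partner i) ≡ true
    absent⇒heavy-partner {i} absent =
      2≤⇒isLarge (subst (λ d → 2 ≤ d + degIn x (partner i)) (isZero⇒≡0 absent) (2≤degIn+degIn-partner i x))

    Saturated Deficient : Fin n → Fin k → Bool
    Saturated y i = Heavy i ∧ isLarge (degIn y i)
    Deficient y i = Heavy i ∧ not (isLarge (degIn y i))

    heavy≡saturated+deficient : ∀ y → # Heavy ≡ # (Saturated y) + # (Deficient y)
    heavy≡saturated+deficient y = #-split Heavy (isLarge ∘ degIn y)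

    deficient-at-witness : ∀ {c} → Heavy c ≡ true → Deficient (witness c) c ≡ true
    deficient-at-witness heavy = ∧-true⁺ heavy (not-true⁺ (≤1⇒¬isLarge (degIn-witness≤1 _)))

    weighted≤Δ : ∀ y (a b : Fin k → Bool) wa wb → (∀ i → wa * 𝟙 (a i) + wb * 𝟙 (b i) ≤ degIn y i) →
                 wa * # a + wb * # b ≤ Δ
    weighted≤Δ y a b wa wb pointwise = subst (_≤ Δ) (∑-weighted a b wa wb)
      (≤-trans (∑-mono-≤ pointwise) (subst (_≤ Δ) (≡.sym (∑degIn≡deg y)) (deg≤Δ y)))

    -- Every class of Q contains a neighbour of y, since its partner contains at most one;
    -- every class saturated at y contains two.
    module DeficientPartners (y : Fin n) (Q : Fin k → Bool)
                             (Q⊆ : ∀ p → Q p ≡ true → Absent p ≡ true × Deficient y (partner p) ≡ true) where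

      Q⇒¬heavy : ∀ {i} → Q i ≡ true → Heavy i ≡ false
      Q⇒¬heavy {i} Qi = absent⇒¬heavy (proj₁ (Q⊆ i Qi))

      saturated⇒∉Q : ∀ {i} → Saturated y i ≡ true → Q i ≡ false
      saturated⇒∉Q {i} saturated with Q i in Qi
      ... | false = refl
      ... | true with () ← trans (≡.sym (proj₁ (∧-true⁻ saturated))) (Q⇒¬heavy Qi)

      Q⇒1≤degIn : ∀ {i} → Q i ≡ true → 1 ≤ degIn y i
      Q⇒1≤degIn {i} Qi = 2≤+⇒≤1⇒1≤ (subst (2 ≤_) (+-comm (degIn y i) _) (2≤degIn+degIn-partner i y))
                                   (¬isLarge⇒≤1 (not-true⁻ (proj₂ (∧-true⁻ (proj₂ (Q⊆ i Qi))))))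

      bound-if-large : (∀ p → Q p ≡ true → 2 ≤ degIn y p) → # Q ≤ Δ + 1 ∸ 2 * suc (# (Saturated y))
      bound-if-large Q⇒2≤ = q≤Δ+1∸2[1+e]-from-pairs (weighted≤Δ y (Saturated y) Q 2 2 λ i →
        weights≤ 2 2 _ saturated⇒∉Q (isLarge⇒2≤ ∘ proj₂ ∘ ∧-true⁻) (Q⇒2≤ i))

      -- The partner of p₀ is deficient, hence neither saturated nor in Q, and contains a neighbour of y.
      bound-if-small : ∀ p₀ → Q p₀ ≡ true → degIn y p₀ ≤ 1 → # Q ≤ Δ + 1 ∸ 2 * suc (# (Saturated y))
      bound-if-small p₀ Qp₀ small-p₀ = q≤Δ+1∸2[1+e]-from-single
        (subst (λ q → 2 * # (Saturated y) + q ≤ Δ) (trans (*-identityˡ (# Q∪c₁)) #Q∪c₁≡#Q+1)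
               (weighted≤Δ y (Saturated y) Q∪c₁ 2 1 λ i →
                  weights≤ 2 1 _ saturated⇒∉Q∪c₁ (isLarge⇒2≤ ∘ proj₂ ∘ ∧-true⁻) Q∪c₁⇒1≤degIn))
        where
        c₁ : Fin k
        c₁ = partner p₀
        heavy-c₁ : Heavy c₁ ≡ true
        heavy-c₁ = proj₁ (∧-true⁻ (proj₂ (Q⊆ p₀ Qp₀)))
        small-c₁ : isLarge (degIn y c₁) ≡ false
        small-c₁ = not-true⁻ (proj₂ (∧-true⁻ {Heavy c₁} (proj₂ (Q⊆ p₀ Qp₀))))
        Q∪c₁ : Fin k → Bool
        Q∪c₁ i = Q i ∨ c₁ ≟ᵇ i
        #Q∪c₁≡#Q+1 : # Q∪c₁ ≡ # Q + 1
        #Q∪c₁≡#Q+1 = trans (#-∨ Q (c₁ ≟ᵇ_) disjoint) (cong (# Q +_) (#[i≟ᵇ_]≡1 c₁))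
          where
          disjoint : ∀ i → Q i ∧ c₁ ≟ᵇ i ≡ false
          disjoint i with Q i in Qi | c₁ ≟ i
          ... | false | _        = refl
          ... | true  | no _     = refl
          ... | true  | yes refl with () ← trans (≡.sym heavy-c₁) (Q⇒¬heavy Qi)
        saturated⇒∉Q∪c₁ : ∀ {i} → Saturated y i ≡ true → Q∪c₁ i ≡ false
        saturated⇒∉Q∪c₁ {i} saturated with c₁ ≟ i
        ... | no _     = cong (_∨ false) (saturated⇒∉Q saturated)
        ... | yes refl with () ← trans (≡.sym (proj₂ (∧-true⁻ {Heavy c₁} saturated))) small-c₁
        Q∪c₁⇒1≤degIn : ∀ {i} → Q∪c₁ i ≡ true → 1 ≤ degIn y i
        Q∪c₁⇒1≤degIn {i} Q∪c₁i with ∨-true⁻ {Q i} Q∪c₁i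
        ... | inj₁ Qi    = Q⇒1≤degIn Qi
        ... | inj₂ c₁≟ᵇi with ≟ᵇ⇒≡ {i = c₁} {i} c₁≟ᵇi
        ...   | refl = 2≤+⇒≤1⇒1≤ (2≤degIn+degIn-partner p₀ y) small-p₀

      #Q≤ : # Q ≤ Δ + 1 ∸ 2 * suc (# (Saturated y))
      #Q≤ with Finₚ.any? (λ p → (Q p Bool.≟ true) ×-dec (degIn y p ≤? 1))
      ... | yes (p₀ , Qp₀ , small-p₀) = bound-if-small p₀ Qp₀ small-p₀
      ... | no  ∄small                = bound-if-large λ p Qp → ≰⇒> λ small → ∄small (p , Qp , small)

    module MinimallySaturated (c₀ : Fin k) (heavy-c₀ : Heavy c₀ ≡ true) where

      y* : Fin n
      y* = proj₁ (argmin x (λ y → # (Saturated y)))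

      e : ℕ
      e = # (Saturated y*)

      e-minimal : ∀ y → e ≤ # (Saturated y)
      e-minimal = proj₂ (argmin x (λ y → # (Saturated y)))

      e<heavy : e < # Heavy
      e<heavy = begin-strict
        e                                                 ≤⟨ e-minimal w ⟩
        # (Saturated w)                                   <⟨ m<m+n _ (#-pos (Deficient w) c₀ (deficient-at-witness heavy-c₀)) ⟩
        # (Saturated w) + # (Deficient w)                 ≡⟨ heavy≡saturated+deficient w ⟨
        # Heavy                                           ∎
        where
        open ≤-Reasoning
        w : Fin n
        w = witness c₀

      M : ℕ
      M = Δ + 1 ∸ 2 * suc e

      deficient-partners≤M : ∀ y (Q : Fin k → Bool) →
                             (∀ p → Q p ≡ true → Absent p ≡ true × Deficient y (partner p) ≡ true) → # Q ≤ M
      deficient-partners≤M y Q Q⊆ =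
        ≤-trans (DeficientPartners.#Q≤ y Q Q⊆) (∸-monoʳ-≤ (Δ + 1) (*-monoʳ-≤ 2 (s≤s (e-minimal y))))

      SaturatedPartner DeficientPartner : Fin k → Bool
      SaturatedPartner p = Absent p ∧ isLarge (degIn y* (partner p))
      DeficientPartner p = Absent p ∧ not (isLarge (degIn y* (partner p)))

      SaturatedPartnerIs : Fin k → Fin k → Bool
      SaturatedPartnerIs c p = SaturatedPartner p ∧ partner p ≟ᵇ c

      -- The absent classes whose partner c is saturated at y* are counted at the witness of c,
      -- where c is deficient.
      fibre-bound : ∀ c → # SaturatedPartnerIs c ≤ M * 𝟙 (Saturated y* c)
      fibre-bound c with Saturated y* c in saturated
      ... | true  = subst (# SaturatedPartnerIs c ≤_) (≡.sym (*-identityʳ M))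
                          (deficient-partners≤M (witness c) (SaturatedPartnerIs c) deficient-at-witness-c)
        where
        deficient-at-witness-c : ∀ p → SaturatedPartnerIs c p ≡ true →
                                 Absent p ≡ true × Deficient (witness c) (partner p) ≡ true
        deficient-at-witness-c p sp∧partner≟ᵇc with ∧-true⁻ {SaturatedPartner p} sp∧partner≟ᵇc
        ... | sp , partner≟ᵇc with ≟ᵇ⇒≡ {i = partner p} {c} partner≟ᵇc
        ...   | refl = proj₁ (∧-true⁻ sp) , deficient-at-witness (proj₁ (∧-true⁻ saturated))
      ... | false = subst (_≤ M * 0) (≡.sym (#-zero (SaturatedPartnerIs c) empty)) z≤n
        where
        empty : ∀ p → SaturatedPartnerIs c p ≡ false
        empty p with SaturatedPartner p in sp | partner p ≟ c
        ... | false | _        = refl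
        ... | true  | no _     = refl
        ... | true  | yes refl with () ← trans (≡.sym (∧-true⁺ (absent⇒heavy-partner (proj₁ (∧-true⁻ sp)))
                                                             (proj₂ (∧-true⁻ sp)))) saturated

      absent≤ : # Absent ≤ suc e * M
      absent≤ = begin
        # Absent
          ≡⟨ #-split Absent (isLarge ∘ degIn y* ∘ partner) ⟩
        # SaturatedPartner + # DeficientPartner
          ≡⟨ cong (_+ # DeficientPartner) (∑-fibres partner SaturatedPartner) ⟨
        ∑[ c < k ] # SaturatedPartnerIs c + # DeficientPartner
          ≤⟨ +-mono-≤ (∑-mono-≤ fibre-bound) (deficient-partners≤M y* DeficientPartner deficient-partner) ⟩
        ∑[ c < k ] (M * 𝟙 (Saturated y* c)) + M
          ≡⟨ cong (_+ M) (*-distribˡ-sum M (𝟙 ∘ Saturated y*)) ⟨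
        M * e + M
          ≡⟨ trans (+-comm (M * e) M) (cong (M +_) (*-comm M e)) ⟩
        suc e * M ∎
        where
        open ≤-Reasoning
        deficient-partner : ∀ p → DeficientPartner p ≡ true → Absent p ≡ true × Deficient y* (partner p) ≡ true
        deficient-partner p dp = let (absent , small) = ∧-true⁻ dp in absent , ∧-true⁺ (absent⇒heavy-partner absent) small

    absent-bound : ∃[ s ] s ≤ # Heavy × # Absent ≤ s * (Δ + 1 ∸ 2 * s)
    absent-bound with # Heavy in #heavy
    ... | zero  = 0 , z≤n , ≤-reflexive (#-zero Absent no-absent)
      where
      no-absent : ∀ p → Absent p ≡ false
      no-absent p with Absent p in absent
      ... | false = refl
      ... | true  with () ← subst (1 ≤_) #heavy (#-pos Heavy (partner p) (absent⇒heavy-partner absent))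
    ... | suc _ with #-witness Heavy (subst (1 ≤_) (≡.sym #heavy) (s≤s z≤n))
    ...   | c₀ , heavy-c₀ = suc e , subst (suc e ≤_) #heavy e<heavy , absent≤
      where open MinimallySaturated c₀ heavy-c₀

    k≤bound : 4 * (δ / 2) ∸ 2 ≤ Δ → k ≤ bound δ Δ
    k≤bound 4h∸2≤Δ with absent-bound
    ... | s , s≤heavy , absent≤ =
      ≤bound (subst (_≤ # Lone + # Heavy + s * (Δ + 1 ∸ 2 * s)) (≡.sym k≡lone+heavy+absent)
                    (+-monoʳ-≤ (# Lone + # Heavy) absent≤))
             lone+2heavy≤δ s≤heavy 4h∸2≤Δ (subst (_≤ Δ) deg-x (deg≤Δ x))

TC2≤bound : ∀ {n} (G : Graph n) {δ Δ} → IsMinDeg G δ → IsMaxDeg G Δ → 4 * (δ / 2) ∸ 2 ≤ Δ → TC2≤ G (bound δ Δ)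
TC2≤bound G (_ , x , deg-x) (deg≤Δ , _) 4h∸2≤Δ k P coalition =
  UpperBound.AtMinimumDegreeVertex.k≤bound G P coalition x deg-x deg≤Δ 4h∸2≤Δ

module Construction (h′ : ℕ) where

  -- r = 2h + 1, written so that Fin r visibly contains 0F, 1F and 2F.
  h r : ℕ
  h = suc h′
  r = 3 + 2 * h′

  data V : Set where
    core : Fin h → Fin r → Fin h → Fin 3 → V
    apex : Fin h → Fin r → V
    top  : Fin h → V

  nCore nRest n : ℕ
  nCore = (h * r) * (h * 3)
  nRest = h * r + h
  n     = nCore + nRest

  enc : V → Fin n
  enc (core i s j a) = combine (combine i s) (combine j a) ↑ˡ nRest
  enc (apex i s)     = nCore ↑ʳ (combine i s ↑ˡ h)
  enc (top i)        = nCore ↑ʳ ((h * r) ↑ʳ i)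

  coreAt : Fin h × Fin r → Fin h × Fin 3 → V
  coreAt (i , s) (j , a) = core i s j a

  decCore : Fin nCore → V
  decCore w = coreAt (remQuot {h} r (proj₁ (remQuot {h * r} (h * 3) w))) (remQuot {h} 3 (proj₂ (remQuot {h * r} (h * 3) w)))

  decRest : Fin nRest → V
  decRest = [ uncurry apex ∘ remQuot {h} r , top ]′ ∘ splitAt (h * r)

  dec : Fin n → V
  dec = [ decCore , decRest ]′ ∘ splitAt nCore

  dec-enc : ∀ v → dec (enc v) ≡ v
  dec-enc (core i s j a) = begin
    dec (enc (core i s j a))
      ≡⟨ cong [ decCore , decRest ]′ (Finₚ.splitAt-↑ˡ nCore (combine (combine i s) (combine j a)) nRest) ⟩
    decCore (combine (combine i s) (combine j a))
      ≡⟨ cong (λ (p : Fin (h * r) × Fin (h * 3)) → coreAt (remQuot r (proj₁ p)) (remQuot 3 (proj₂ p)))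
              (Finₚ.remQuot-combine (combine i s) (combine j a)) ⟩
    coreAt (remQuot r (combine i s)) (remQuot 3 (combine j a))
      ≡⟨ cong₂ coreAt (Finₚ.remQuot-combine i s) (Finₚ.remQuot-combine j a) ⟩
    core i s j a ∎
    where open ≡-Reasoning
  dec-enc (apex i s) = begin
    dec (enc (apex i s))
      ≡⟨ cong [ decCore , decRest ]′ (Finₚ.splitAt-↑ʳ nCore nRest _) ⟩
    decRest (combine i s ↑ˡ h)
      ≡⟨ cong [ uncurry apex ∘ remQuot r , top ]′ (Finₚ.splitAt-↑ˡ (h * r) (combine i s) h) ⟩
    uncurry apex (remQuot r (combine i s))
      ≡⟨ cong (uncurry apex) (Finₚ.remQuot-combine i s) ⟩
    apex i s ∎
    where open ≡-Reasoning
  dec-enc (top i) = trans (cong [ decCore , decRest ]′ (Finₚ.splitAt-↑ʳ nCore nRest _))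
                          (cong [ uncurry apex ∘ remQuot r , top ]′ (Finₚ.splitAt-↑ʳ (h * r) h i))

  enc-decCore : ∀ w → enc (decCore w) ≡ w ↑ˡ nRest
  enc-decCore w = cong (_↑ˡ nRest)
    (trans (cong₂ combine (Finₚ.combine-remQuot {h} r (proj₁ rq)) (Finₚ.combine-remQuot {h} 3 (proj₂ rq)))
           (Finₚ.combine-remQuot (h * 3) w))
    where
    rq : Fin (h * r) × Fin (h * 3)
    rq = remQuot {h * r} (h * 3) w

  enc-decRest : ∀ w → enc (decRest w) ≡ nCore ↑ʳ w
  enc-decRest w with splitAt (h * r) w in eq
  ... | inj₁ is = cong (nCore ↑ʳ_) (trans (cong (_↑ˡ h) (Finₚ.combine-remQuot r is)) (Finₚ.splitAt⁻¹-↑ˡ eq))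
  ... | inj₂ i  = cong (nCore ↑ʳ_) (Finₚ.splitAt⁻¹-↑ʳ eq)

  enc-dec : ∀ u → enc (dec u) ≡ u
  enc-dec u with splitAt nCore u in eq
  ... | inj₁ w = trans (enc-decCore w) (Finₚ.splitAt⁻¹-↑ˡ eq)
  ... | inj₂ w = trans (enc-decRest w) (Finₚ.splitAt⁻¹-↑ʳ eq)

  enc-injective : ∀ {v w} → enc v ≡ enc w → v ≡ w
  enc-injective {v} {w} eq = trans (≡.sym (dec-enc v)) (trans (cong dec eq) (dec-enc w))

  Σcore Σapex Σtop ΣV : (V → ℕ) → ℕ
  Σcore f = ∑[ i < h ] ∑[ s < r ] ∑[ j < h ] ∑[ a < 3 ] f (core i s j a)
  Σapex f = ∑[ i < h ] ∑[ s < r ] f (apex i s)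
  Σtop  f = ∑[ i < h ] f (top i)
  ΣV    f = Σcore f + (Σapex f + Σtop f)

  ∑∘dec : ∀ f → sum (f ∘ dec) ≡ ΣV f
  ∑∘dec f = trans (∑-+ nCore nRest (f ∘ dec))
                  (cong₂ _+_ coreSum (trans (∑-+ (h * r) h (λ x → f (dec (nCore ↑ʳ x)))) (cong₂ _+_ apexSum topSum)))
    where
    f∘dec∘enc : ∀ v → f (dec (enc v)) ≡ f v
    f∘dec∘enc v = cong f (dec-enc v)
    coreSum : ∑[ x < nCore ] f (dec (x ↑ˡ nRest)) ≡ Σcore f
    coreSum = trans (∑-* (h * r) (h * 3) (λ x → f (dec (x ↑ˡ nRest))))
                (trans (∑-* h r (λ is → ∑[ ja < h * 3 ] f (dec (combine is ja ↑ˡ nRest))))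
                (sum-cong-≗ λ i → sum-cong-≗ λ s → trans (∑-* h 3 (λ ja → f (dec (combine (combine i s) ja ↑ˡ nRest))))
                (sum-cong-≗ λ j → sum-cong-≗ λ a → f∘dec∘enc (core i s j a))))
    apexSum : ∑[ x < h * r ] f (dec (nCore ↑ʳ (x ↑ˡ h))) ≡ Σapex f
    apexSum = trans (∑-* h r (λ x → f (dec (nCore ↑ʳ (x ↑ˡ h)))))
                    (sum-cong-≗ λ i → sum-cong-≗ λ s → f∘dec∘enc (apex i s))
    topSum : ∑[ x < h ] f (dec (nCore ↑ʳ ((h * r) ↑ʳ x))) ≡ Σtop f
    topSum = sum-cong-≗ λ i → f∘dec∘enc (top i)

  isLow : Fin 3 → Bool
  isLow 2F = false
  isLow _  = true

  topEdge : Fin h → Fin r → Fin h → Bool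
  topEdge y 0F            j = true
  topEdge y 1F            j = not (y ≟ᵇ j)
  topEdge y (suc (suc _)) j = false

  sameGadget : Fin h → Fin r → Fin h → Fin r → Bool
  sameGadget i s i′ s′ = i ≟ᵇ i′ ∧ s ≟ᵇ s′

  topCore : Fin h → Fin h → Fin r → Fin h → Fin 3 → Bool
  topCore y i s j a = 0F ≟ᵇ i ∧ (topEdge y s j ∧ a ≟ᵇ 2F)

  _~_ : V → V → Bool
  core i s j a ~ core i′ s′ j′ a′ = sameGadget i s i′ s′ ∧ not (a ≟ᵇ a′)
  core i s j a ~ apex i′ s′       = sameGadget i s i′ s′ ∧ isLow a
  core i s j a ~ top y            = topCore y i s j a
  apex i s     ~ core i′ s′ j a   = sameGadget i s i′ s′ ∧ isLow a
  apex _ _     ~ apex _ _         = false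
  apex i _     ~ top y            = i ≟ᵇ y
  top y        ~ core i s j a     = topCore y i s j a
  top y        ~ apex i _         = y ≟ᵇ i
  top _        ~ top _            = false

  ~-sym : ∀ v w → v ~ w ≡ w ~ v
  ~-sym (core i s j a) (core i′ s′ j′ a′) rewrite ≟ᵇ-sym i i′ | ≟ᵇ-sym s s′ | ≟ᵇ-sym a a′ = refl
  ~-sym (core i s j a) (apex i′ s′)       rewrite ≟ᵇ-sym i i′ | ≟ᵇ-sym s s′ = refl
  ~-sym (core i s j a) (top y)            = refl
  ~-sym (apex i s)     (core i′ s′ j a)   rewrite ≟ᵇ-sym i i′ | ≟ᵇ-sym s s′ = refl
  ~-sym (apex i s)     (apex i′ s′)       = refl
  ~-sym (apex i s)     (top y)            = ≟ᵇ-sym i y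
  ~-sym (top y)        (core i s j a)     = refl
  ~-sym (top y)        (apex i s)         = ≟ᵇ-sym y i
  ~-sym (top y)        (top y′)           = refl

  ~-irrefl : ∀ v → v ~ v ≡ false
  ~-irrefl (core i s j a) rewrite ≟ᵇ-refl i | ≟ᵇ-refl s | ≟ᵇ-refl a = refl
  ~-irrefl (apex i s)     = refl
  ~-irrefl (top y)        = refl

  graph : Graph n
  graph = record { adj = λ u w → dec u ~ dec w ; sym = λ u w → ~-sym (dec u) (dec w) ; irrefl = ~-irrefl ∘ dec }

  adj-enc : ∀ v w → adj graph (enc v) (enc w) ≡ v ~ w
  adj-enc v w = cong₂ _~_ (dec-enc v) (dec-enc w)

  deg-graph : ∀ u → deg graph u ≡ ΣV (𝟙 ∘ (dec u ~_))
  deg-graph u = trans (count≡# (adj graph u)) (∑∘dec (𝟙 ∘ (dec u ~_)))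

  deg-enc : ∀ v → deg graph (enc v) ≡ ΣV (𝟙 ∘ (v ~_))
  deg-enc v = trans (deg-graph (enc v)) (cong (λ w → ΣV (𝟙 ∘ (w ~_))) (dec-enc v))

  ∑gadget : ∀ i₀ s₀ (W : Fin h → Fin 3 → Bool) →
            ∑[ i < h ] ∑[ s < r ] ∑[ j < h ] ∑[ a < 3 ] 𝟙 (sameGadget i₀ s₀ i s ∧ W j a) ≡
            ∑[ j < h ] ∑[ a < 3 ] 𝟙 (W j a)
  ∑gadget i₀ s₀ W =
    trans (∑∑-point _ i₀ s₀ λ i s off → ∑-zero _ λ j → ∑-zero _ λ a → cong (λ b → 𝟙 (b ∧ W j a)) off)
          (cong (λ b → ∑[ j < h ] ∑[ a < 3 ] 𝟙 (b ∧ W j a)) (cong₂ _∧_ (≟ᵇ-refl i₀) (≟ᵇ-refl s₀)))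

  ∑apex-gadget : ∀ i₀ s₀ b → ∑[ i < h ] ∑[ s < r ] 𝟙 (sameGadget i₀ s₀ i s ∧ b) ≡ 𝟙 b
  ∑apex-gadget i₀ s₀ b =
    trans (∑∑-point _ i₀ s₀ λ i s off → cong (λ c → 𝟙 (c ∧ b)) off)
          (cong (λ c → 𝟙 (c ∧ b)) (cong₂ _∧_ (≟ᵇ-refl i₀) (≟ᵇ-refl s₀)))

  ∑other-parts : ∀ a₀ → ∑[ a < 3 ] 𝟙 (not (a₀ ≟ᵇ a)) ≡ 2
  ∑other-parts 0F = refl
  ∑other-parts 1F = refl
  ∑other-parts 2F = refl

  ∑[j<h]2≡2h : ∀ (w : Fin 3 → ℕ) → sum w ≡ 2 → ∑[ j < h ] sum w ≡ 2 * h
  ∑[j<h]2≡2h w ∑w≡2 rewrite ∑w≡2 = trans (∑-const h 2) (*-comm h 2)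

  deg-core : ∀ i s j a → ΣV (𝟙 ∘ (core i s j a ~_)) ≡ 2 * h + (𝟙 (isLow a) + # (λ y → topCore y i s j a))
  deg-core i s j a =
    cong₂ _+_ (trans (∑gadget i s (λ _ a′ → not (a ≟ᵇ a′))) (∑[j<h]2≡2h (λ a′ → 𝟙 (not (a ≟ᵇ a′))) (∑other-parts a)))
              (cong (_+ # (λ y → topCore y i s j a)) (∑apex-gadget i s (isLow a)))

  deg-apex : ∀ i s → ΣV (𝟙 ∘ (apex i s ~_)) ≡ 2 * h + 1
  deg-apex i s = cong₂ _+_ (trans (∑gadget i s (λ _ → isLow)) (∑[j<h]2≡2h (𝟙 ∘ isLow) refl))
                           (cong₂ _+_ no-apex (#[i≟ᵇ_]≡1 i))
    where
    no-apex : Σapex (𝟙 ∘ (apex i s ~_)) ≡ 0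
    no-apex = ∑-zero (λ (_ : Fin h) → ∑[ s′ < r ] 0) λ _ → ∑-zero (λ (_ : Fin r) → 0) λ _ → refl

  ∑[a<3]𝟙[b∧a≟2] : ∀ b → ∑[ a < 3 ] 𝟙 (b ∧ a ≟ᵇ 2F) ≡ 𝟙 b
  ∑[a<3]𝟙[b∧a≟2] true  = refl
  ∑[a<3]𝟙[b∧a≟2] false = refl

  ∑topEdge : ∀ y → ∑[ s < r ] # (topEdge y s) ≡ h + # (λ j → not (y ≟ᵇ j))
  ∑topEdge y = cong₂ _+_ (#-all h)
    (trans (cong (# (λ j → not (y ≟ᵇ j)) +_) (∑-zero _ λ s → #-zero (topEdge y (suc (suc s))) λ _ → refl))
           (+-identityʳ _))

  Σcore-top : ∀ y → Σcore (𝟙 ∘ (top y ~_)) ≡ ∑[ s < r ] # (topEdge y s)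
  Σcore-top y = begin
    Σcore (𝟙 ∘ (top y ~_))
      ≡⟨ ∑-point (λ i → ∑[ s < r ] ∑[ j < h ] ∑[ a < 3 ] 𝟙 (topCore y i s j a)) 0F (λ i i≢0 →
           ∑-zero _ λ s → ∑-zero _ λ j → ∑-zero (λ a → 𝟙 (topCore y i s j a)) λ a →
           cong (λ b → 𝟙 (b ∧ (topEdge y s j ∧ a ≟ᵇ 2F))) (≢⇒≟ᵇ≡false (i≢0 ∘ ≡.sym))) ⟩
    ∑[ s < r ] ∑[ j < h ] ∑[ a < 3 ] 𝟙 (topEdge y s j ∧ a ≟ᵇ 2F)
      ≡⟨ sum-cong-≗ (λ s → sum-cong-≗ λ j → ∑[a<3]𝟙[b∧a≟2] (topEdge y s j)) ⟩
    ∑[ s < r ] # (topEdge y s) ∎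
    where open ≡-Reasoning

  1+Σcore-top : ∀ y → 1 + Σcore (𝟙 ∘ (top y ~_)) ≡ 2 * h
  1+Σcore-top y = begin
    1 + Σcore (𝟙 ∘ (top y ~_)) ≡⟨ cong (1 +_) (trans (Σcore-top y) (∑topEdge y)) ⟩
    1 + (h + m)                ≡⟨ e h m ⟩
    h + (1 + m)                ≡⟨ cong (h +_) 1+m≡h ⟩
    h + h                      ≡⟨ cong (h +_) (+-identityʳ h) ⟨
    2 * h                      ∎
    where
    open ≡-Reasoning
    m : ℕ
    m = # (λ j → not (y ≟ᵇ j))
    1+m≡h : 1 + m ≡ h
    1+m≡h = trans (cong (_+ m) (≡.sym (#[i≟ᵇ_]≡1 y))) (#-complement (y ≟ᵇ_))
    e : ∀ h m → 1 + (h + m) ≡ h + (1 + m)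
    e = solve-∀

  deg-top : ∀ y → ΣV (𝟙 ∘ (top y ~_)) ≡ 4 * h
  deg-top y = +-cancelˡ-≡ 1 _ _ (begin
    1 + (Σcore (𝟙 ∘ (top y ~_)) + (Σapex (𝟙 ∘ (top y ~_)) + Σtop (𝟙 ∘ (top y ~_))))
      ≡⟨ cong (λ z → 1 + (Σcore (𝟙 ∘ (top y ~_)) + z)) (cong₂ _+_ apexes no-top) ⟩
    1 + (Σcore (𝟙 ∘ (top y ~_)) + (r + 0))
      ≡⟨ e (Σcore (𝟙 ∘ (top y ~_))) r ⟩
    (1 + Σcore (𝟙 ∘ (top y ~_))) + r
      ≡⟨ cong (_+ r) (1+Σcore-top y) ⟩
    2 * h + r
      ≡⟨ e′ h′ ⟩
    1 + 4 * h ∎)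
    where
    open ≡-Reasoning
    e : ∀ c r → 1 + (c + (r + 0)) ≡ (1 + c) + r
    e = solve-∀
    e′ : ∀ h′ → 2 * suc h′ + (3 + 2 * h′) ≡ 1 + 4 * suc h′
    e′ = solve-∀
    apexes : Σapex (𝟙 ∘ (top y ~_)) ≡ r
    apexes = begin
      ∑[ i < h ] ∑[ s < r ] 𝟙 (y ≟ᵇ i) ≡⟨ sum-cong-≗ (λ i → ∑-const r (𝟙 (y ≟ᵇ i))) ⟩
      ∑[ i < h ] (r * 𝟙 (y ≟ᵇ i))     ≡⟨ *-distribˡ-sum r (𝟙 ∘ (y ≟ᵇ_)) ⟨
      r * # (y ≟ᵇ_)                   ≡⟨ cong (r *_) (#[i≟ᵇ_]≡1 y) ⟩
      r * 1                           ≡⟨ *-identityʳ r ⟩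
      r ∎
    no-top : Σtop (𝟙 ∘ (top y ~_)) ≡ 0
    no-top = ∑-zero (λ (_ : Fin h) → 0) λ _ → refl

  degree-bounds : ∀ v → 2 * h ≤ ΣV (𝟙 ∘ (v ~_)) × ΣV (𝟙 ∘ (v ~_)) ≤ 4 * h
  degree-bounds (core i s j a) rewrite deg-core i s j a =
    m≤m+n (2 * h) _ ,
    ≤-trans (+-monoʳ-≤ (2 * h) (≤-trans (+-mono-≤ (𝟙≤1 (isLow a)) (#≤n (λ y → topCore y i s j a))) 1+h≤2h))
            (≤-reflexive (e h))
    where
    e : ∀ h → 2 * h + 2 * h ≡ 4 * h
    e = solve-∀
    1+h≤2h : 1 + h ≤ 2 * h
    1+h≤2h = subst (_≤ 2 * h) (+-comm h 1) (+-monoʳ-≤ h (s≤s (z≤n {h′ + 0})))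
  degree-bounds (apex i s) rewrite deg-apex i s = m≤m+n (2 * h) 1 , 2h+1≤4h
    where
    e : ∀ h′ → 4 * suc h′ ≡ 2 * suc h′ + 1 + (1 + 2 * h′)
    e = solve-∀
    2h+1≤4h : 2 * h + 1 ≤ 4 * h
    2h+1≤4h = subst (2 * h + 1 ≤_) (≡.sym (e h′)) (m≤m+n (2 * h + 1) _)
  degree-bounds (top y) rewrite deg-top y = 2h≤4h , ≤-refl
    where
    2h≤4h : 2 * h ≤ 4 * h
    2h≤4h = *-monoˡ-≤ h {2} {4} (s≤s (s≤s z≤n))

  minimum-vertex : V
  minimum-vertex = core 0F 2F 0F 2F

  deg-minimum-vertex : ΣV (𝟙 ∘ (minimum-vertex ~_)) ≡ 2 * h
  deg-minimum-vertex = trans (deg-core 0F 2F 0F 2F) (trans (cong (2 * h +_) (#-zero (λ y → topCore y 0F 2F 0F 2F) λ _ → refl))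
                                                          (+-identityʳ (2 * h)))

  isMinDeg : IsMinDeg graph (2 * h)
  isMinDeg = (λ u → subst (2 * h ≤_) (≡.sym (deg-graph u)) (proj₁ (degree-bounds (dec u))))
           , enc minimum-vertex , trans (deg-enc minimum-vertex) deg-minimum-vertex

  isMaxDeg : IsMaxDeg graph (4 * h)
  isMaxDeg = (λ u → subst (_≤ 4 * h) (≡.sym (deg-graph u)) (proj₂ (degree-bounds (dec u))))
           , enc (top 0F) , trans (deg-enc (top 0F)) (deg-top 0F)

  K : ℕ
  K = h + h * r

  classC : Fin h → Fin K
  classC j = j ↑ˡ (h * r)

  classP : Fin h → Fin r → Fin K
  classP i s = h ↑ʳ combine i s

  data ClassView : Fin K → Set where
    isC : ∀ j → ClassView (classC j)
    isP : ∀ i s → ClassView (classP i s)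

  classView : ∀ κ → ClassView κ
  classView κ with splitAt h κ in eq
  ... | inj₁ j = subst ClassView (Finₚ.splitAt⁻¹-↑ˡ eq) (isC j)
  ... | inj₂ w = subst ClassView (trans (cong (h ↑ʳ_) (Finₚ.combine-remQuot {h} r w)) (Finₚ.splitAt⁻¹-↑ʳ eq))
                       (isP (proj₁ (remQuot {h} r w)) (proj₂ (remQuot {h} r w)))

  classC≢classP : ∀ j i s → classC j ≢ classP i s
  classC≢classP j i s eq with () ← trans (≡.sym (Finₚ.splitAt-↑ˡ h j (h * r)))
                                         (trans (cong (splitAt h) eq) (Finₚ.splitAt-↑ʳ h (h * r) (combine i s)))

  classOf : V → Fin K
  classOf (core _ _ j _) = classC j
  classOf (apex i s)     = classP i s
  classOf (top i)        = classP i 0F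

  partition : Partition n K
  partition = record { cls = classOf ∘ dec ; surj = classOf∘dec-surjective }
    where
    hit : ∀ v → classOf (dec (enc v)) ≡ classOf v
    hit v = cong classOf (dec-enc v)
    classOf∘dec-surjective : ∀ κ → ∃[ u ] classOf (dec u) ≡ κ
    classOf∘dec-surjective κ with classView κ
    ... | isC j   = enc (core 0F 0F j 0F) , hit (core 0F 0F j 0F)
    ... | isP i s = enc (apex i s) , hit (apex i s)

  class : Fin K → VSet n
  class = classSet partition

  class≡ : ∀ κ v → class κ (enc v) ≡ classOf v ≟ᵇ κ
  class≡ κ v = trans (classSet≡ partition κ (enc v)) (cong (λ w → classOf w ≟ᵇ κ) (dec-enc v))

  ∈class : ∀ v → class (classOf v) (enc v) ≡ true
  ∈class v = trans (class≡ (classOf v) v) (≟ᵇ-refl (classOf v))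

  topCore-true : ∀ {y i s j a} → topCore y i s j a ≡ true → i ≡ 0F × a ≡ 2F × (s ≡ 0F ⊎ (s ≡ 1F × y ≢ j))
  topCore-true {y} {i} {s} {j} {a} adjacent with ∧-true⁻ {0F ≟ᵇ i} adjacent
  ... | 0≟ᵇi , edge-a with ∧-true⁻ {topEdge y s j} edge-a
  ...   | edge , a≟ᵇ2 = ≡.sym (≟ᵇ⇒≡ 0≟ᵇi) , ≟ᵇ⇒≡ a≟ᵇ2 , topEdge-true s edge
    where
    topEdge-true : ∀ s → topEdge y s j ≡ true → s ≡ 0F ⊎ (s ≡ 1F × y ≢ j)
    topEdge-true 0F _ = inj₁ refl
    topEdge-true 1F y≢ᵇj = inj₂ (refl , ≟ᵇ≡false⇒≢ (not-true⁻ y≢ᵇj))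

  undominated-by : ∀ κ v w → (∀ x → v ~ x ∧ classOf x ≟ᵇ κ ≡ true → x ≡ w) → ¬ IsT2D graph (class κ)
  undominated-by κ v w only = ¬T2D-by-vertex graph (class κ) (enc v) (enc w) λ u adj∧∈ →
    trans (≡.sym (enc-dec u)) (cong enc (only (dec u)
      (subst (_≡ true) (cong₂ (λ v′ b → v′ ~ dec u ∧ b) (dec-enc v) (classSet≡ partition κ u)) adj∧∈)))

  classC-undominated : ∀ i → ¬ IsT2D graph (class (classC i))
  classC-undominated i = undominated-by (classC i) (top i) (core 0F 0F i 2F) only
    where
    only : ∀ v → top i ~ v ∧ classOf v ≟ᵇ classC i ≡ true → v ≡ core 0F 0F i 2F
    only (apex i′ s′) adj∧∈
      with () ← classC≢classP i i′ s′ (≡.sym (≟ᵇ⇒≡ (proj₂ (∧-true⁻ {i ≟ᵇ i′} adj∧∈))))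
    only (top y)      ()
    only (core i′ s′ j a) adj∧∈ with ∧-true⁻ {topCore i i′ s′ j a} adj∧∈
    ... | adjacent , ∈C with Finₚ.↑ˡ-injective (h * r) j i (≟ᵇ⇒≡ ∈C) | topCore-true {i} {i′} {s′} {j} {a} adjacent
    ...   | refl | refl , refl , inj₁ refl           = refl
    ...   | refl | refl , refl , inj₂ (refl , i≢i) with () ← i≢i refl

  classP-undominated : ∀ i s → ¬ IsT2D graph (class (classP i s))
  classP-undominated i s = undominated-by (classP i s) (apex i s) (top i) only
    where
    only : ∀ v → apex i s ~ v ∧ classOf v ≟ᵇ classP i s ≡ true → v ≡ top i
    only (core i′ s′ j a) adj∧∈
      with () ← classC≢classP j i s (≟ᵇ⇒≡ (proj₂ (∧-true⁻ {sameGadget i s i′ s′ ∧ isLow a} adj∧∈)))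
    only (apex i′ s′)     ()
    only (top y)          adj∧∈ = cong top (≡.sym (≟ᵇ⇒≡ (proj₁ (∧-true⁻ {i ≟ᵇ y} adj∧∈))))

  sameGadget-refl : ∀ i s → sameGadget i s i s ≡ true
  sameGadget-refl i s = cong₂ _∧_ (≟ᵇ-refl i) (≟ᵇ-refl s)

  core~core : ∀ i s j a j′ a′ → not (a ≟ᵇ a′) ≡ true → core i s j a ~ core i s j′ a′ ≡ true
  core~core i s j a j′ a′ a≢a′ = cong₂ _∧_ (sameGadget-refl i s) a≢a′

  apex~core : ∀ i s j a → isLow a ≡ true → apex i s ~ core i s j a ≡ true
  apex~core i s j a low = cong₂ _∧_ (sameGadget-refl i s) low

  two-neighbours : ∀ v (S : VSet n) w₁ w₂ → w₁ ≢ w₂ → v ~ w₁ ≡ true → v ~ w₂ ≡ true →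
                   S (enc w₁) ≡ true → S (enc w₂) ≡ true → 2 ≤ count (λ u → v ~ dec u ∧ S u)
  two-neighbours v S w₁ w₂ w₁≢w₂ v~w₁ v~w₂ w₁∈S w₂∈S =
    subst (2 ≤_) (≡.sym (count≡# (λ u → v ~ dec u ∧ S u)))
          (#-two (λ u → v ~ dec u ∧ S u) (enc w₁) (enc w₂)
                 (neighbour w₁ v~w₁ w₁∈S) (neighbour w₂ v~w₂ w₂∈S) (w₁≢w₂ ∘ enc-injective))
    where
    neighbour : ∀ w → v ~ w ≡ true → S (enc w) ≡ true → v ~ dec (enc w) ∧ S (enc w) ≡ true
    neighbour w v~w w∈S = subst (λ x → v ~ x ∧ S (enc w) ≡ true) (≡.sym (dec-enc w)) (∧-true⁺ v~w w∈S)

  dominating : ∀ i s (S : VSet n) → (∀ i′ s′ a → S (enc (core i′ s′ i a)) ≡ true) → S (enc (apex i s)) ≡ true →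
               IsT2D graph S
  dominating i s S C⊆S apex∈S u = dominated (dec u)
    where
    dominated : ∀ v → 2 ≤ count (λ u → v ~ dec u ∧ S u)
    dominated (core i′ s′ j 0F) = two-neighbours (core i′ s′ j 0F) S (core i′ s′ i 1F) (core i′ s′ i 2F) (λ ())
      (core~core i′ s′ j 0F i 1F refl) (core~core i′ s′ j 0F i 2F refl) (C⊆S i′ s′ 1F) (C⊆S i′ s′ 2F)
    dominated (core i′ s′ j 1F) = two-neighbours (core i′ s′ j 1F) S (core i′ s′ i 0F) (core i′ s′ i 2F) (λ ())
      (core~core i′ s′ j 1F i 0F refl) (core~core i′ s′ j 1F i 2F refl) (C⊆S i′ s′ 0F) (C⊆S i′ s′ 2F)
    dominated (core i′ s′ j 2F) = two-neighbours (core i′ s′ j 2F) S (core i′ s′ i 0F) (core i′ s′ i 1F) (λ ())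
      (core~core i′ s′ j 2F i 0F refl) (core~core i′ s′ j 2F i 1F refl) (C⊆S i′ s′ 0F) (C⊆S i′ s′ 1F)
    dominated (apex i′ s′) = two-neighbours (apex i′ s′) S (core i′ s′ i 0F) (core i′ s′ i 1F) (λ ())
      (apex~core i′ s′ i 0F refl) (apex~core i′ s′ i 1F refl) (C⊆S i′ s′ 0F) (C⊆S i′ s′ 1F)
    dominated (top y) with y ≟ i
    ... | yes refl = two-neighbours (top y) S (core 0F 0F y 2F) (apex y s) (λ ())
      refl (≟ᵇ-refl y) (C⊆S 0F 0F 2F) apex∈S
    ... | no  y≢i  = two-neighbours (top y) S (core 0F 0F i 2F) (core 0F 1F i 2F) (λ ())
      refl (cong (λ b → not b ∧ true) (≢⇒≟ᵇ≡false y≢i)) (C⊆S 0F 0F 2F) (C⊆S 0F 1F 2F)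

  ∪-left : ∀ (U W : VSet n) {u} → U u ≡ true → unionSet U W u ≡ true
  ∪-left U W {u} U∋u = cong (_∨ W u) U∋u

  ∪-right : ∀ (U W : VSet n) {u} → W u ≡ true → unionSet U W u ≡ true
  ∪-right U W {u} W∋u = trans (cong (U u ∨_) W∋u) (∨-zeroʳ (U u))

  coalition : IsT2CoalitionPartition graph partition
  coalition κ with classView κ
  ... | isC i   = classP i 0F , classC≢classP i i 0F , classC-undominated i , classP-undominated i 0F ,
                  dominating i 0F (unionSet C P) (λ i′ s′ a → ∪-left C P (∈class (core i′ s′ i a)))
                                                 (∪-right C P (∈class (apex i 0F)))
    where
    C P : VSet n
    C = class (classC i)
    P = class (classP i 0F)
  ... | isP i s = classC i , classC≢classP i i s ∘ ≡.sym , classP-undominated i s , classC-undominated i ,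
                  dominating i s (unionSet P C) (λ i′ s′ a → ∪-right P C (∈class (core i′ s′ i a)))
                                                (∪-left P C (∈class (apex i s)))
    where
    C P : VSet n
    C = class (classC i)
    P = class (classP i s)

  hub : V
  hub = core 0F 0F 0F 2F

  ⇝hub-via : ∀ v w → v ~ w ≡ true → Reach graph (enc w) (enc hub) → Reach graph (enc v) (enc hub)
  ⇝hub-via v w v~w = step (trans (adj-enc v w) v~w)

  top⇝hub : ∀ y → Reach graph (enc (top y)) (enc hub)
  top⇝hub y = ⇝hub-via (top y) hub refl here

  apex⇝hub : ∀ i s → Reach graph (enc (apex i s)) (enc hub)
  apex⇝hub i s = ⇝hub-via (apex i s) (top i) (≟ᵇ-refl i) (top⇝hub i)

  lowCore⇝hub : ∀ i s j a → isLow a ≡ true → Reach graph (enc (core i s j a)) (enc hub)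
  lowCore⇝hub i s j a low =
    ⇝hub-via (core i s j a) (apex i s) (trans (~-sym (core i s j a) (apex i s)) (apex~core i s j a low)) (apex⇝hub i s)

  reaches-hub : ∀ v → Reach graph (enc v) (enc hub)
  reaches-hub (top y)         = top⇝hub y
  reaches-hub (apex i s)      = apex⇝hub i s
  reaches-hub (core i s j 0F) = lowCore⇝hub i s j 0F refl
  reaches-hub (core i s j 1F) = lowCore⇝hub i s j 1F refl
  reaches-hub (core i s j 2F) = ⇝hub-via (core i s j 2F) (core i s j 0F) (core~core i s j 2F j 0F refl) (lowCore⇝hub i s j 0F refl)

  connected : Connected graph
  connected u v = Reach-trans (to-hub u) (Reach-sym (to-hub v))
    where
    to-hub : ∀ u → Reach graph u (enc hub)
    to-hub u = subst (λ x → Reach graph x (enc hub)) (enc-dec u) (reaches-hub (dec u))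

  isMinDeg[h*2] : IsMinDeg graph (h * 2)
  isMinDeg[h*2] = subst (IsMinDeg graph) (*-comm 2 h) isMinDeg

  4[h*2/2]∸2≤4h : 4 * (h * 2 / 2) ∸ 2 ≤ 4 * h
  4[h*2/2]∸2≤4h = subst (λ q → 4 * q ∸ 2 ≤ 4 * h) (≡.sym (m*n/n≡m h 2)) (m∸n≤m (4 * h) 2)

  bound≡K : bound (h * 2) (4 * h) ≡ K
  bound≡K = begin
    h * 2 / 2 * (4 * h + 1 ∸ 2 * (h * 2 / 2)) + (h * 2 + 1) / 2
      ≡⟨ cong₂ (λ a c → a * (4 * h + 1 ∸ 2 * a) + c) (m*n/n≡m h 2) ⌈h*2/2⌉≡h ⟩
    h * (4 * h + 1 ∸ 2 * h) + h
      ≡⟨ cong (λ q → h * q + h) 4h+1∸2h≡r ⟩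
    h * r + h
      ≡⟨ +-comm (h * r) h ⟩
    K ∎
    where
    open ≡-Reasoning
    e : ∀ h′ → 4 * suc h′ + 1 ≡ 2 * suc h′ + (3 + 2 * h′)
    e = solve-∀
    4h+1∸2h≡r : 4 * h + 1 ∸ 2 * h ≡ r
    4h+1∸2h≡r = trans (cong (_∸ 2 * h) (e h′)) (m+n∸m≡n (2 * h) r)
    e′ : ∀ h → h * 2 ≡ h + h
    e′ = solve-∀
    ⌈h*2/2⌉≡h : (h * 2 + 1) / 2 ≡ h
    ⌈h*2/2⌉≡h = +-cancelˡ-≡ h _ _
      (trans (cong (_+ (h * 2 + 1) / 2) (≡.sym (m*n/n≡m h 2))) (trans (/2+[1+]/2≡ (h * 2)) (e′ h)))

  TC2≡bound : TC2≡ graph (bound (h * 2) (4 * h))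
  TC2≡bound = subst (λ m → Σ (Partition n m) (IsT2CoalitionPartition graph)) (≡.sym bound≡K) (partition , coalition)
            , TC2≤bound graph isMinDeg[h*2] isMaxDeg 4[h*2/2]∸2≤4h

theorem3p8 : (∀ (n : ℕ) (G : Graph n) (δ Δ : ℕ) → Connected G → IsMinDeg G δ → IsMaxDeg G Δ →
                2 ≤ δ → 4 * (δ / 2) ∸ 2 ≤ Δ → TC2≤ G (bound δ Δ))
             × (∀ (δ : ℕ) → 2 ≤ δ → 2 ∣ δ →
                ∃[ n ] ∃[ G ] ∃[ Δ ] (Connected {n} G × IsMinDeg G δ × IsMaxDeg G Δ ×
                  4 * (δ / 2) ∸ 2 ≤ Δ × TC2≡ G (bound δ Δ)))
theorem3p8 = (λ n G δ Δ _ minδ maxΔ _ → TC2≤bound G minδ maxΔ) , sharp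
  where
  sharp : ∀ (δ : ℕ) → 2 ≤ δ → 2 ∣ δ →
          ∃[ n ] ∃[ G ] ∃[ Δ ] (Connected {n} G × IsMinDeg G δ × IsMaxDeg G Δ ×
                                 4 * (δ / 2) ∸ 2 ≤ Δ × TC2≡ G (bound δ Δ))
  sharp ._ () (divides zero refl)
  sharp ._ _  (divides (suc h′) refl) =
    n , graph , 4 * h , connected , isMinDeg[h*2] , isMaxDeg , 4[h*2/2]∸2≤4h , TC2≡bound
    where open Construction h′
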